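{- Let $\mathcal{T}$ be a formula tree and $\nu$ an assignment from boxes to $\{\mathit{true},\mathit{false}\}$. The value of $\mathcal{T}$ under $\nu$ is true if and only if there is $i_0\in\mathbb{N}$ such that the value of the cut $\mathcal{T}^{i_0}$ under $\nu$ is true.
   Context: Boxes are subsets of $Q\times Q$ for a finite set $Q$. A formula tree is a (possibly infinite) rooted tree whose leaves are labeled by boxes and whose inner nodes are labeled by $\wedge$ or $\vee$ and have at least one child; the empty tree is identified with $\mathit{false}$. Given $\nu$, let $e_\nu$ be the set of leaves whose box $\nu$ maps to true. For a set $e$ of nodes, $p(e)$ is $e$ together with all $\vee$-nodes having some child in $e$ and all $\wedge$-nodes all of whose children are in $e$. The value of a tree under $\nu$ is true iff its root lies in $\bigcup_{i\in\mathbb{N}}p^i(e_\nu)$. For a set $S$ of nodes, the prefix $\mathcal{T}^S$ is obtained by (1) marking all subtrees with root in $S$, (2) repeating until a fixed point: marking every $\vee$-node all of whose children are marked and every $\wedge$-node some child of which is marked, together with their subtrees, (3) deleting all marked nodes. The cut at level $i$, $\mathcal{T}^i$, is $\mathcal{T}^{S_i}$ where $S_i$ is the set of nodes of depth strictly greater than $i$ (the root has depth $0$). -}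

module Defs where

open import Data.Nat using (ℕ; zero; suc; _<_)
open import Data.Bool using (Bool; true)
open import Data.Fin using (Fin)
open import Data.List using (List; []; _∷_; length)
open import Data.Product using (Σ; ∃; _×_)
open import Data.Sum using (_⊎_)
open import Relation.Nullary using (¬_)
open import Relation.Binary.PropositionalEquality using (_≡_)

-- Boxes over the finite set Q = Fin n : subsets of Q × Q (characteristic functions).
Box : ℕ → Set
Box n = Fin n → Fin n → Bool

data Label (B : Set) : Set where
  box  : B → Label B
  conj : Label B
  disj : Label B

-- A node is addressed by the path from the root, written in REVERSE order:
-- the child of node w along branch k is  k ∷ w ; the root is [] ; the depth of w is length w.
Addr : Set → Set
Addr A = List A

record FTree (A B : Set) : Set₁ where
  field
    Nd  : Addr A → Set
    lab : Addr A → Label B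
    parent   : ∀ {k w} → Nd (k ∷ w) → Nd w
    leaf-nochild : ∀ {w b k} → Nd w → lab w ≡ box b → ¬ Nd (k ∷ w)
    conj-child   : ∀ {w} → Nd w → lab w ≡ conj → ∃ λ k → Nd (k ∷ w)
    disj-child   : ∀ {w} → Nd w → lab w ≡ disj → ∃ λ k → Nd (k ∷ w)

module _ {A B : Set} where

  -- Semantics is given for an arbitrary node set Nd with labelling lab
  -- (so that it applies both to a tree and to its prefixes, which keep the labels).

  eν : (Addr A → Set) → (Addr A → Label B) → (B → Bool) → Addr A → Set
  eν Nd lab ν w = Nd w × Σ B (λ b → lab w ≡ box b × ν b ≡ true)

  p : (Addr A → Set) → (Addr A → Label B) → (Addr A → Set) → Addr A → Set
  p Nd lab e w =
    e w
    ⊎ (Nd w × lab w ≡ disj × ∃ (λ k → Nd (k ∷ w) × e (k ∷ w)))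
    ⊎ (Nd w × lab w ≡ conj × (∀ k → Nd (k ∷ w) → e (k ∷ w)))

  piter : (Addr A → Set) → (Addr A → Label B) → (B → Bool) → ℕ → Addr A → Set
  piter Nd lab ν zero    = eν Nd lab ν
  piter Nd lab ν (suc i) = p Nd lab (piter Nd lab ν i)

  ValueTrue : (Addr A → Set) → (Addr A → Label B) → (B → Bool) → Set
  ValueTrue Nd lab ν = ∃ λ i → piter Nd lab ν i []

  data Marked (Nd : Addr A → Set) (lab : Addr A → Label B) (S : Addr A → Set) : Addr A → Set where
    base : ∀ {w} → Nd w → S w → Marked Nd lab S w
    down : ∀ {k w} → Nd (k ∷ w) → Marked Nd lab S w → Marked Nd lab S (k ∷ w)
    orM  : ∀ {w} → Nd w → lab w ≡ disj →
           (∀ k → Nd (k ∷ w) → Marked Nd lab S (k ∷ w)) → Marked Nd lab S w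
    andM : ∀ {w} k → Nd w → lab w ≡ conj →
           Nd (k ∷ w) → Marked Nd lab S (k ∷ w) → Marked Nd lab S w

  PrefixNd : (Addr A → Set) → (Addr A → Label B) → (Addr A → Set) → Addr A → Set
  PrefixNd Nd lab S w = Nd w × ¬ Marked Nd lab S w

  Deeper : ℕ → Addr A → Set
  Deeper i w = i < length w

  CutNd : (Addr A → Set) → (Addr A → Label B) → ℕ → Addr A → Set
  CutNd Nd lab i = PrefixNd Nd lab (Deeper i)

-- A cut only deletes nodes, and a ∧-node survives a cut only if all its children do, so an
-- evaluation inside a cut is an evaluation inside the tree.  Conversely, if the root enters
-- p^j(e_ν) after j rounds, follow that evaluation downwards from the root: every node it uses
-- has depth at most j, so none of them is in S_j, and none is marked by the closure rules
-- either, since a used ∨-node has a used child and all children of a used ∧-node are used.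
-- The same evaluation therefore takes place in the cut at level j.
module Submission where

open import Defs
open import Data.Nat using (ℕ; zero; suc; _+_; _≤_)
open import Data.Nat.Properties using (≤-refl; ≤-trans; +-suc; n≤1+n; +-monoʳ-≤; m≤m+n; <⇒≱)
open import Data.Bool using (Bool)
open import Data.List using ([]; _∷_; length)
open import Data.Product using (∃; _,_; proj₁)
open import Data.Sum using (inj₁; inj₂)
open import Data.Empty using (⊥)
open import Relation.Nullary using (¬_)
open import Relation.Binary.PropositionalEquality using (_≡_; _≢_; sym; trans; subst)
open import Function.Bundles using (_⇔_; mk⇔)

module _ {A B : Set} (Nd : Addr A → Set) (lab : Addr A → Label B) (ν : B → Bool) where

  private
    conj≢disj : conj {B} ≢ disj
    conj≢disj ()

    box≢disj : ∀ {b : B} → box b ≢ disj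
    box≢disj ()

    box≢conj : ∀ {b : B} → box b ≢ conj
    box≢conj ()

    conflict : ∀ {w} {l l′ : Label B} → l ≢ l′ → lab w ≡ l → lab w ≡ l′ → ⊥
    conflict l≢l′ p q = l≢l′ (trans (sym p) q)

  piter-prefix⇒piter : ∀ S m {w} → piter (PrefixNd Nd lab S) lab ν m w → piter Nd lab ν m w
  piter-prefix⇒piter S zero ((n , _) , leaf) = n , leaf
  piter-prefix⇒piter S (suc m) (inj₁ e) = inj₁ (piter-prefix⇒piter S m e)
  piter-prefix⇒piter S (suc m) (inj₂ (inj₁ ((n , _) , d , k , (nk , _) , e))) =
    inj₂ (inj₁ (n , d , k , nk , piter-prefix⇒piter S m e))
  piter-prefix⇒piter S (suc m) (inj₂ (inj₂ ((n , unmarked) , c , all))) =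
    inj₂ (inj₂ (n , c , λ k nk → piter-prefix⇒piter S m
      (all k (nk , λ marked → unmarked (andM k n c nk marked)))))

  -- Used w m : node w is used by the evaluation of the root in round j, and lies in p^m(e_ν).
  data Used (j : ℕ) : Addr A → ℕ → Set where
    root  : piter Nd lab ν j [] → Used j [] j
    lower : ∀ {w m} → Used j w (suc m) → piter Nd lab ν m w → Used j w m
    child : ∀ {w m} k → Used j w (suc m) → piter Nd lab ν m (k ∷ w) → Used j (k ∷ w) m

  module _ {j : ℕ} where

    used-piter : ∀ {w m} → Used j w m → piter Nd lab ν m w
    used-piter (root r) = r
    used-piter (lower _ e) = e
    used-piter (child _ _ e) = e

    used-depth : ∀ {w m} → Used j w m → length w + m ≤ j
    used-depth (root _) = ≤-refl
    used-depth {w} {m} (lower u _) = ≤-trans (+-monoʳ-≤ (length w) (n≤1+n m)) (used-depth u)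
    used-depth {m = m} (child {w} _ u _) = subst (_≤ j) (+-suc (length w) m) (used-depth u)

    used-parent : ∀ {k w m} → Used j (k ∷ w) m → ∃ (Used j w)
    used-parent (lower u _) = used-parent u
    used-parent (child _ u _) = _ , u

    MarkedCut : Addr A → Set
    MarkedCut = Marked Nd lab (Deeper {A} {B} j)

    used-unmarked : ∀ {w m} → Used j w m → ¬ MarkedCut w
    used-disj-unmarked : ∀ {w m} → lab w ≡ disj → (∀ k → Nd (k ∷ w) → MarkedCut (k ∷ w)) →
                         Used j w m → piter Nd lab ν m w → ⊥
    used-conj-unmarked : ∀ {w m} k → lab w ≡ conj → Nd (k ∷ w) → MarkedCut (k ∷ w) →
                         Used j w m → piter Nd lab ν m w → ⊥

    used-unmarked {w} {m} u (base _ deep) = <⇒≱ deep (≤-trans (m≤m+n (length w) m) (used-depth u))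
    used-unmarked u (down _ marked) with used-parent u
    ... | _ , u′ = used-unmarked u′ marked
    used-unmarked u (orM _ d all) = used-disj-unmarked d all u (used-piter u)
    used-unmarked u (andM k _ c nk marked) = used-conj-unmarked k c nk marked u (used-piter u)

    used-disj-unmarked {m = zero} d _ _ (_ , _ , l , _) = conflict box≢disj l d
    used-disj-unmarked {m = suc m} d all u (inj₁ e) = used-disj-unmarked d all (lower u e) e
    used-disj-unmarked {m = suc m} _ all u (inj₂ (inj₁ (_ , _ , k , nk , e))) =
      used-unmarked (child k u e) (all k nk)
    used-disj-unmarked {m = suc m} d _ _ (inj₂ (inj₂ (_ , c , _))) = conflict conj≢disj c d

    used-conj-unmarked {m = zero} _ c _ _ _ (_ , _ , l , _) = conflict box≢conj l c
    used-conj-unmarked {m = suc m} k c nk marked u (inj₁ e) =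
      used-conj-unmarked k c nk marked (lower u e) e
    used-conj-unmarked {m = suc m} _ c _ _ _ (inj₂ (inj₁ (_ , d , _))) = conflict conj≢disj c d
    used-conj-unmarked {m = suc m} k _ nk marked u (inj₂ (inj₂ (_ , _ , all))) =
      used-unmarked (child k u (all k nk)) marked

    used⇒piter-cut : ∀ m {w} → Used j w m → piter (CutNd Nd lab j) lab ν m w
    used⇒piter-cut zero u with used-piter u
    ... | n , leaf = (n , used-unmarked u) , leaf
    used⇒piter-cut (suc m) u with used-piter u
    ... | inj₁ e = inj₁ (used⇒piter-cut m (lower u e))
    ... | inj₂ (inj₁ (n , d , k , nk , e)) =
      inj₂ (inj₁ ((n , used-unmarked u) , d , k , (nk , used-unmarked (child k u e)) ,
                  used⇒piter-cut m (child k u e)))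
    ... | inj₂ (inj₂ (n , c , all)) =
      inj₂ (inj₂ ((n , used-unmarked u) , c ,
                  λ k nk → used⇒piter-cut m (child k u (all k (proj₁ nk)))))

  value⇒value-cut : ValueTrue Nd lab ν → ∃ λ i₀ → ValueTrue (CutNd Nd lab i₀) lab ν
  value⇒value-cut (j , r) = j , j , used⇒piter-cut j (root r)

  value-cut⇒value : (∃ λ i₀ → ValueTrue (CutNd Nd lab i₀) lab ν) → ValueTrue Nd lab ν
  value-cut⇒value (i₀ , m , r) = m , piter-prefix⇒piter (Deeper {A} {B} i₀) m r

lemma12 : (A : Set) (n : ℕ) (T : FTree A (Box n)) (ν : Box n → Bool) →
          ValueTrue (FTree.Nd T) (FTree.lab T) ν
            ⇔ ∃ (λ i₀ → ValueTrue (CutNd (FTree.Nd T) (FTree.lab T) i₀) (FTree.lab T) ν)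
lemma12 A n T ν = mk⇔ (value⇒value-cut Nd lab ν) (value-cut⇒value Nd lab ν)
  where open FTree T
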